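{- Consider a cuckoo filter storing a set of $n$ elements, with block size $b$, $N$ hash table cells, fingerprint size $f$, and load factor $1-\delta=n/(Nb)$, where the filter is either a (simplified) cuckoo filter without a stash or a simplified cuckoo filter with a stash. Then, for any fixed query element $y$ not in the set, the probability (over the random hash functions) that the query for $y$ answers positively (the false positive rate) is at most $\frac{2n}{N(2^f-1)}=\frac{2b(1-\delta)}{2^f-1}$.
   Context: A simplified cuckoo filter with $N$ cells (indexed $0,\dots,N-1$, $N$ a power of two), block size $b$ and fingerprint length $f$ uses two independent uniformly random hash functions: $\phi$, mapping each potential element to a nonzero $f$-bit number (its fingerprint, uniform over the $2^f-1$ nonzero values), and $h_1$, mapping each potential element to a uniform index in $\{0,\dots,N-1\}$. Each cell holds up to $b$ fingerprints; the fingerprint of each stored element $x$ is stored (one copy per element) in cell $h_1(x)$ or cell $h_1(x)\oplus\phi(x)$ ($\oplus$ = bitwise exclusive or). Without a stash, a query for $y$ answers positively iff $\phi(y)$ appears among the fingerprints stored in cells $h_1(y)$ and $h_1(y)\oplus\phi(y)$. With a stash: the cells are partitioned into subtables of $2^f$ cells sharing the same high-order $\log_2 N-f$ index bits, and each subtable has a stash holding pairs (location, fingerprint); an element $x$ whose fingerprint could not be placed in the table is instead recorded in the stash of its subtable as the pair consisting of the low-order $f$ bits of $\min(h_1(x),h_1(x)\oplus\phi(x))$ and $\phi(x)$. A query for $y$ answers positively iff $\phi(y)$ appears in cell $h_1(y)$ or $h_1(y)\oplus\phi(y)$, or the pair (low-order $f$ bits of $\min(h_1(y),h_1(y)\oplus\phi(y))$,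 $\phi(y)$) appears in the stash of the subtable of $y$. -}

module Defs where

open import Data.Bool using (Bool; true; false; _∧_; _∨_; not; _xor_; if_then_else_)
import Data.Bool.Properties as BoolP
open import Data.Nat using (ℕ; zero; suc; _+_; _*_; _^_; _≤ᵇ_)
open import Data.Fin using (Fin)
open import Data.Vec using (Vec; []; _∷_; zipWith; replicate; foldr; lookup; map; tabulate)
import Data.Vec.Properties as VecP
open import Data.List using (List; []; _∷_; length; filterᵇ; cartesianProduct; concatMap; allFin)
import Data.List as L
open import Data.Maybe using (Maybe; just; nothing)
open import Data.Product using (_×_; _,_; proj₁; proj₂)
open import Relation.Nullary.Decidable using (⌊_⌋)

Bits : ℕ → Set
Bits f = Vec Bool f

_==_ : ∀ {f} → Bits f → Bits f → Bool
u == v = ⌊ VecP.≡-dec BoolP._≟_ u v ⌋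

-- numeric value of a bit string, head = most significant bit
val : ∀ {f} → Bits f → ℕ
val [] = 0
val {suc f} (x ∷ xs) = (if x then 2 ^ f else 0) + val xs

allBits : (f : ℕ) → List (Bits f)
allBits zero = [] ∷ []
allBits (suc f) = concatMap (λ x → L.map (x ∷_) (allBits f)) (true ∷ false ∷ [])

isNonzero : ∀ {f} → Bits f → Bool
isNonzero v = not (v == replicate _ false)

Fingerprints : (f : ℕ) → List (Bits f)
Fingerprints f = filterᵇ isNonzero (allBits f)

-- A cell index of a table with N = 2^(k+f) cells, split into its
-- k high-order bits (the subtable) and its f low-order bits.
Idx : ℕ → ℕ → Set
Idx k f = Bits k × Bits f

allIdx : (k f : ℕ) → List (Idx k f)
allIdx k f = cartesianProduct (allBits k) (allBits f)

idxVal : ∀ {k f} → Idx k f → ℕ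
idxVal {k} {f} (hi , lo) = val hi * 2 ^ f + val lo

_==ᵢ_ : ∀ {k f} → Idx k f → Idx k f → Bool
(h , l) ==ᵢ (h' , l') = (h == h') ∧ (l == l')

-- i ⊕ φ  (φ is an f-bit number, so only low-order bits change)
_⊕_ : ∀ {k f} → Idx k f → Bits f → Idx k f
(hi , lo) ⊕ φ = hi , zipWith _xor_ lo φ

minIdx : ∀ {k f} → Idx k f → Idx k f → Idx k f
minIdx i j = if idxVal i ≤ᵇ idxVal j then i else j

stashLoc : ∀ {k f} → Idx k f → Bits f → Bits f
stashLoc h φ = proj₂ (minIdx h (h ⊕ φ))

allVec : ∀ {a} {A : Set a} → List A → (m : ℕ) → List (Vec A m)
allVec xs zero = [] ∷ []
allVec xs (suc m) = concatMap (λ x → L.map (x ∷_) (allVec xs m)) xs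

count : ∀ {a} {A : Set a} → (A → Bool) → List A → ℕ
count p xs = length (filterᵇ p xs)

data Mode : Set where
  noStash withStash : Mode

-- location of a stored element's fingerprint:
-- just false = cell h₁(x), just true = cell h₁(x) ⊕ φ(x), nothing = stash
Loc : Set
Loc = Maybe Bool

cellOf : ∀ {k f} → Idx k f → Bits f → Bool → Idx k f
cellOf h φ false = h
cellOf h φ true  = h ⊕ φ

anyᵥ : ∀ {n} {A : Set} → (A → Bool) → Vec A n → Bool
anyᵥ p = foldr _ (λ x r → p x ∨ r) false

allᵥ : ∀ {n} {A : Set} → (A → Bool) → Vec A n → Bool
allᵥ p = foldr _ (λ x r → p x ∧ r) true

anyₗ : ∀ {A : Set} → (A → Bool) → List A → Bool
anyₗ p = L.foldr (λ x r → p x ∨ r) false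

allₗ : ∀ {A : Set} → (A → Bool) → List A → Bool
allₗ p = L.foldr (λ x r → p x ∧ r) true

load : ∀ {k f n} → Vec (Bits f) n → Vec (Idx k f) n → Vec Loc n → Idx k f → ℕ
load {n = n} φs hs ls c =
  count (λ i → inCell (lookup φs i) (lookup hs i) (lookup ls i)) (allFin n)
  where
  inCell : _ → _ → Loc → Bool
  inCell φ h (just s) = cellOf h φ s ==ᵢ c
  inCell φ h nothing  = false

valid : ∀ {k f n} → Mode → ℕ → Vec (Bits f) n → Vec (Idx k f) n → Vec Loc n → Bool
valid {k} {f} mode b φs hs ls =
  noStashOk mode ∧ allₗ (λ c → load φs hs ls c ≤ᵇ b) (allIdx k f)
  where
  isJust : Loc → Bool
  isJust (just _) = true
  isJust nothing = false
  noStashOk : Mode → Bool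
  noStashOk noStash = allᵥ isJust ls
  noStashOk withStash = true

-- the answer of the query for an element with fingerprint φy and h₁ value hy,
-- given stored elements with fingerprints φs, h₁ values hs, locations ls
query : ∀ {k f n} → Mode → Vec (Bits f) n → Vec (Idx k f) n → Vec Loc n
      → Bits f → Idx k f → Bool
query {n = n} mode φs hs ls φy hy =
  anyₗ (λ i → tableHit (lookup φs i) (lookup hs i) (lookup ls i)) (allFin n)
  ∨ stashHit mode
  where
  tableHit : _ → _ → Loc → Bool
  tableHit φ h (just s) = (φ == φy) ∧ ((cellOf h φ s ==ᵢ hy) ∨ (cellOf h φ s ==ᵢ (hy ⊕ φy)))
  tableHit φ h nothing  = false
  -- pair (stashLoc, φ) recorded in the stash of the query's subtable
  stashEntry : _ → _ → Loc → Bool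
  stashEntry φ h nothing = (proj₁ h == proj₁ hy) ∧ (stashLoc h φ == stashLoc hy φy) ∧ (φ == φy)
  stashEntry φ h (just _) = false
  stashHit : Mode → Bool
  stashHit noStash = false
  stashHit withStash =
    anyₗ (λ i → stashEntry (lookup φs i) (lookup hs i) (lookup ls i)) (allFin n)

-- The probability space: φ uniform over nonzero f-bit values and h₁
-- uniform over cells, independently for each of the m potential elements.

HashSpace : (m k f : ℕ) → List (Vec (Bits f) m × Vec (Idx k f) m)
HashSpace m k f = cartesianProduct (allVec (Fingerprints f) m) (allVec (allIdx k f) m)

-- A construction rule: from the hash values of the n stored elements,
-- either fails (nothing) or produces the location of each stored fingerprint.
Rule : (n k f : ℕ) → Set
Rule n k f = Vec (Bits f) n → Vec (Idx k f) n → Maybe (Vec Loc n)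

built : ∀ {m n k f} → Mode → ℕ → Rule n k f → Vec (Fin m) n
      → Vec (Bits f) m × Vec (Idx k f) m → Bool
built mode b rule S (φ , h) with rule (map (lookup φ) S) (map (lookup h) S)
... | just ls = valid mode b (map (lookup φ) S) (map (lookup h) S) ls
... | nothing = false

builtAndPositive : ∀ {m n k f} → Mode → ℕ → Rule n k f → Vec (Fin m) n → Fin m
                 → Vec (Bits f) m × Vec (Idx k f) m → Bool
builtAndPositive mode b rule S y (φ , h) with rule (map (lookup φ) S) (map (lookup h) S)
... | just ls = valid mode b (map (lookup φ) S) (map (lookup h) S) ls
                ∧ query mode (map (lookup φ) S) (map (lookup h) S) ls (lookup φ y) (lookup h y)
... | nothing = false

module Submission where

-- Counting form of the bound: every probability is a number of hash
-- assignments (φ , h₁) divided by the size of the hash space, so we show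
--   #(built ∧ y positive) · N · (2^f - 1)  ≤  2n · #(built).
-- The argument is a resampling one.  Multiplying the left count by the number
-- N · (2^f - 1) of possible values of (h₁(y) , φ(y)) turns it into a sum over
-- all assignments (φ , h₁) and all choices (a , c) overwriting (φ(y) , h₁(y)).
-- Since y is not stored, the filter built from (φ , h₁) does not change, and a
-- fixed built filter answers positively for at most 2n pairs (a , c): a stored
-- element with fingerprint φ and home cell E (the cell holding its fingerprint,
-- or h₁ when it is stashed) only answers queries with fingerprint φ and
-- h₁ ∈ {E , E ⊕ φ}.  For the stash this uses that min(h , h ⊕ φ) together
-- with the subtable determines the pair {h , h ⊕ φ}.

open import Defs
open import Algebra.Properties.CommutativeSemigroup as CommSemigroup using ()
open import Data.Bool using (Bool; true; false; _∧_; _∨_; not; _xor_)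
import Data.Bool.Properties as Boolₚ
open import Data.Empty using (⊥; ⊥-elim)
open import Data.Fin using (Fin; zero; suc)
open import Data.List using (List; []; _∷_; length; filterᵇ; cartesianProduct; concatMap; allFin; _++_)
import Data.List as List
open import Data.List.Properties using (length-tabulate)
import Data.List.Membership.Propositional as List
open import Data.List.Relation.Unary.Any using (here; there)
open import Data.Maybe using (Maybe; just; nothing)
open import Data.Nat using (ℕ; zero; suc; _*_; _^_; _+_; _∸_; _≤_; _≤ᵇ_; z≤n; s≤s)
open import Data.Nat.Properties
open import Data.Product using (_×_; _,_; proj₁; ∃-syntax)
open import Data.Sum using (_⊎_; inj₁; inj₂)
open import Data.Vec using (Vec; []; _∷_; lookup; map; zipWith; replicate; _[_]≔_)
import Data.Vec.Properties as Vecₚ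
open import Data.Vec.Membership.Propositional using (_∈_)
import Data.Vec.Relation.Unary.Any as VecAny
open import Function.Bundles using (mk⇔; Equivalence)
open import Relation.Nullary using (¬_; Dec; yes; no)
open import Relation.Nullary.Decidable using (does; isYes; isYes≗does; dec-true; does-⇔; toWitness)
open import Relation.Binary.PropositionalEquality

private
  variable
    A B : Set

⟦_⟧ : Bool → ℕ
⟦ true ⟧  = 1
⟦ false ⟧ = 0

∑ : List A → (A → ℕ) → ℕ
∑ []       g = 0
∑ (x ∷ xs) g = g x + ∑ xs g

syntax ∑ L (λ x → e) = ∑[ x ← L ] e

∑-cong : (L : List A) {g h : A → ℕ} → (∀ x → g x ≡ h x) → ∑ L g ≡ ∑ L h
∑-cong []      e = refl
∑-cong (x ∷ L) e = cong₂ _+_ (e x) (∑-cong L e)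

∑-mono : (L : List A) {g h : A → ℕ} → (∀ x → g x ≤ h x) → ∑ L g ≤ ∑ L h
∑-mono []      e = z≤n
∑-mono (x ∷ L) e = +-mono-≤ (e x) (∑-mono L e)

∑-++ : (L M : List A) (g : A → ℕ) → ∑ (L ++ M) g ≡ ∑ L g + ∑ M g
∑-++ []      M g = refl
∑-++ (x ∷ L) M g = trans (cong (g x +_) (∑-++ L M g)) (sym (+-assoc (g x) _ _))

∑-+ : (L : List A) (g h : A → ℕ) → ∑[ x ← L ] (g x + h x) ≡ ∑ L g + ∑ L h
∑-+ []      g h = refl
∑-+ (x ∷ L) g h =
  trans (cong (g x + h x +_) (∑-+ L g h))
        (CommSemigroup.interchange +-commutativeSemigroup (g x) (h x) _ _)

∑-*ˡ : (L : List A) (c : ℕ) (g : A → ℕ) → ∑[ x ← L ] (c * g x) ≡ c * ∑ L g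
∑-*ˡ []      c g = sym (*-zeroʳ c)
∑-*ˡ (x ∷ L) c g = trans (cong (c * g x +_) (∑-*ˡ L c g)) (sym (*-distribˡ-+ c (g x) _))

∑-*ʳ : (L : List A) (c : ℕ) (g : A → ℕ) → ∑[ x ← L ] (g x * c) ≡ ∑ L g * c
∑-*ʳ L c g = trans (∑-cong L (λ x → *-comm (g x) c)) (trans (∑-*ˡ L c g) (*-comm c _))

∑-const : (L : List A) (c : ℕ) → ∑[ _ ← L ] c ≡ length L * c
∑-const []      c = refl
∑-const (x ∷ L) c = cong (c +_) (∑-const L c)

∑-zero : (L : List A) → ∑[ _ ← L ] 0 ≡ 0
∑-zero L = trans (∑-const L 0) (*-zeroʳ (length L))

∑-zero₂ : (L : List A) (M : List B) → ∑[ _ ← L ] ∑[ _ ← M ] 0 ≡ 0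
∑-zero₂ L M = trans (∑-cong L (λ _ → ∑-zero M)) (∑-zero L)

length≡∑1 : (L : List A) → length L ≡ ∑[ _ ← L ] 1
length≡∑1 L = sym (trans (∑-const L 1) (*-identityʳ _))

∑-swap : (L : List A) (M : List B) (g : A → B → ℕ) →
         ∑[ x ← L ] ∑[ y ← M ] g x y ≡ ∑[ y ← M ] ∑[ x ← L ] g x y
∑-swap []      M g = sym (∑-zero M)
∑-swap (x ∷ L) M g =
  trans (cong (∑ M (g x) +_) (∑-swap L M g)) (sym (∑-+ M (g x) (λ y → ∑[ x ← L ] g x y)))

∑-map : (f : A → B) (L : List A) (g : B → ℕ) → ∑ (List.map f L) g ≡ ∑[ x ← L ] g (f x)
∑-map f []      g = refl
∑-map f (x ∷ L) g = cong (g (f x) +_) (∑-map f L g)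

∑-concatMap : (f : A → List B) (L : List A) (g : B → ℕ) →
              ∑ (concatMap f L) g ≡ ∑[ x ← L ] ∑ (f x) g
∑-concatMap f []      g = refl
∑-concatMap f (x ∷ L) g = trans (∑-++ (f x) (concatMap f L) g) (cong (∑ (f x) g +_) (∑-concatMap f L g))

∑-cartesian : (L : List A) (M : List B) (g : A × B → ℕ) →
              ∑ (cartesianProduct L M) g ≡ ∑[ x ← L ] ∑[ y ← M ] g (x , y)
∑-cartesian []      M g = refl
∑-cartesian (x ∷ L) M g =
  trans (∑-++ (List.map (x ,_) M) _ g) (cong₂ _+_ (∑-map (x ,_) M g) (∑-cartesian L M g))

count≡∑ : (p : A → Bool) (L : List A) → count p L ≡ ∑[ x ← L ] ⟦ p x ⟧
count≡∑ p []      = refl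
count≡∑ p (x ∷ L) with p x
... | true  = cong suc (count≡∑ p L)
... | false = count≡∑ p L

∑-filter-≤ : (p : A → Bool) (L : List A) (g : A → ℕ) → ∑ (filterᵇ p L) g ≤ ∑ L g
∑-filter-≤ p []      g = z≤n
∑-filter-≤ p (x ∷ L) g with p x
... | true  = +-monoʳ-≤ (g x) (∑-filter-≤ p L g)
... | false = ≤-trans (∑-filter-≤ p L g) (m≤n+m _ (g x))

∑-member : {x : A} {L : List A} (g : A → ℕ) → x List.∈ L → g x ≤ ∑ L g
∑-member {L = y ∷ L} g (here refl) = m≤m+n (g y) _
∑-member {L = y ∷ L} g (there x∈L) = ≤-trans (∑-member g x∈L) (m≤n+m _ (g y))

∧-true : ∀ {x y} → x ∧ y ≡ true → x ≡ true × y ≡ true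
∧-true {true} {true} _ = refl , refl

∨-true : ∀ {x y} → x ∨ y ≡ true → x ≡ true ⊎ y ≡ true
∨-true {true}  _ = inj₁ refl
∨-true {false} e = inj₂ e

⟦∧⟧ : ∀ x y → ⟦ x ∧ y ⟧ ≡ ⟦ x ⟧ * ⟦ y ⟧
⟦∧⟧ true  y = sym (+-identityʳ _)
⟦∧⟧ false y = refl

⟦⟧+⟦not⟧ : ∀ x → ⟦ x ⟧ + ⟦ not x ⟧ ≡ 1
⟦⟧+⟦not⟧ true  = refl
⟦⟧+⟦not⟧ false = refl

false≢true : false ≡ true → ⊥
false≢true ()

⟦⟧-≤ : (x : Bool) {S : ℕ} → (x ≡ true → 1 ≤ S) → ⟦ x ⟧ ≤ S
⟦⟧-≤ true  h = h refl
⟦⟧-≤ false h = z≤n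

any-witness : (p : A → Bool) (L : List A) → anyₗ p L ≡ true →
              ∃[ x ] (x List.∈ L × p x ≡ true)
any-witness p (x ∷ L) e with p x in px
... | true  = x , here refl , px
... | false with any-witness p L e
...   | z , z∈L , pz = z , there z∈L , pz

∑-allVec : (L : List A) (m : ℕ) (g : Vec A (suc m) → ℕ) →
           ∑ (allVec L (suc m)) g ≡ ∑[ x ← L ] ∑[ w ← allVec L m ] g (x ∷ w)
∑-allVec L m g = trans (∑-concatMap _ L g) (∑-cong L (λ x → ∑-map (x ∷_) (allVec L m) g))

∑-resample : (L : List A) {m : ℕ} (y : Fin m) (G : Vec A m → ℕ) →
             ∑ (allVec L m) G * length L ≡ ∑[ v ← allVec L m ] ∑[ a ← L ] G (v [ y ]≔ a)
∑-resample L {suc m} zero G = begin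
    ∑ (allVec L (suc m)) G * length L    ≡⟨ cong (_* length L) (∑-allVec L m G) ⟩
    S * length L                         ≡⟨ *-comm S (length L) ⟩
    length L * S                         ≡⟨ sym (∑-const L S) ⟩
    ∑[ _ ← L ] S                         ≡⟨ ∑-cong L (λ _ → ∑-swap L (allVec L m) (λ x w → G (x ∷ w))) ⟩
    ∑[ _ ← L ] ∑[ w ← allVec L m ] ∑[ a ← L ] G (a ∷ w)
                                         ≡⟨ sym (∑-allVec L m _) ⟩
    ∑[ v ← allVec L (suc m) ] ∑[ a ← L ] G (v [ zero ]≔ a)  ∎
  where
  open ≡-Reasoning
  S : ℕ
  S = ∑[ x ← L ] ∑[ w ← allVec L m ] G (x ∷ w)
∑-resample L {suc m} (suc y) G = begin
    ∑ (allVec L (suc m)) G * length L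
      ≡⟨ cong (_* length L) (∑-allVec L m G) ⟩
    (∑[ x ← L ] ∑[ w ← allVec L m ] G (x ∷ w)) * length L
      ≡⟨ sym (∑-*ʳ L (length L) _) ⟩
    ∑[ x ← L ] (∑[ w ← allVec L m ] G (x ∷ w) * length L)
      ≡⟨ ∑-cong L (λ x → ∑-resample L y (λ w → G (x ∷ w))) ⟩
    ∑[ x ← L ] ∑[ w ← allVec L m ] ∑[ a ← L ] G (x ∷ (w [ y ]≔ a))
      ≡⟨ sym (∑-allVec L m _) ⟩
    ∑[ v ← allVec L (suc m) ] ∑[ a ← L ] G (v [ suc y ]≔ a)  ∎
  where open ≡-Reasoning

∑-resample₂ : {A B : Set} (LA : List A) (LB : List B) {m : ℕ} (y : Fin m)
              (G : Vec A m → Vec B m → ℕ) →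
  (∑[ φ ← allVec LA m ] ∑[ h ← allVec LB m ] G φ h) * (length LB * length LA)
  ≡ ∑[ φ ← allVec LA m ] ∑[ h ← allVec LB m ] ∑[ a ← LA ] ∑[ c ← LB ] G (φ [ y ]≔ a) (h [ y ]≔ c)
∑-resample₂ {A} {B} LA LB {m} y G = begin
    (∑[ φ ← VA ] ∑[ h ← VB ] G φ h) * (length LB * length LA)
      ≡⟨ sym (*-assoc (∑[ φ ← VA ] ∑[ h ← VB ] G φ h) (length LB) (length LA)) ⟩
    (∑[ φ ← VA ] ∑[ h ← VB ] G φ h) * length LB * length LA
      ≡⟨ cong (_* length LA) (sym (∑-*ʳ VA (length LB) _)) ⟩
    (∑[ φ ← VA ] (∑[ h ← VB ] G φ h * length LB)) * length LA
      ≡⟨ cong (_* length LA) (∑-cong VA (λ φ → ∑-resample LB y (G φ))) ⟩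
    (∑[ φ ← VA ] ∑[ h ← VB ] ∑[ c ← LB ] G φ (h [ y ]≔ c)) * length LA
      ≡⟨ ∑-resample LA y _ ⟩
    ∑[ φ ← VA ] ∑[ a ← LA ] ∑[ h ← VB ] ∑[ c ← LB ] G (φ [ y ]≔ a) (h [ y ]≔ c)
      ≡⟨ ∑-cong VA (λ φ → ∑-swap LA VB _) ⟩
    ∑[ φ ← VA ] ∑[ h ← VB ] ∑[ a ← LA ] ∑[ c ← LB ] G (φ [ y ]≔ a) (h [ y ]≔ c)  ∎
  where
  open ≡-Reasoning
  VA : List (Vec A m)
  VA = allVec LA m
  VB : List (Vec B m)
  VB = allVec LB m

count-HashSpace : ∀ {m k f} (p : Vec (Bits f) m × Vec (Idx k f) m → Bool) →
  count p (HashSpace m k f)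
  ≡ ∑[ φ ← allVec (Fingerprints f) m ] ∑[ h ← allVec (allIdx k f) m ] ⟦ p (φ , h) ⟧
count-HashSpace {m} {k} {f} p =
  trans (count≡∑ p (HashSpace m k f)) (∑-cartesian (allVec (Fingerprints f) m) (allVec (allIdx k f) m) _)

_≟ᵥ_ : ∀ {f} (u v : Bits f) → Dec (u ≡ v)
_≟ᵥ_ = Vecₚ.≡-dec Boolₚ._≟_

==⇒≡ : ∀ {f} (u v : Bits f) → (u == v) ≡ true → u ≡ v
==⇒≡ u v e = toWitness {a? = u ≟ᵥ v} (Equivalence.from Boolₚ.T-≡ e)

==-refl : ∀ {f} (u : Bits f) → (u == u) ≡ true
==-refl u = trans (isYes≗does (u ≟ᵥ u)) (dec-true (u ≟ᵥ u) refl)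

==-sym : ∀ {f} (u v : Bits f) → (u == v) ≡ (v == u)
==-sym u v = begin
    isYes (u ≟ᵥ v)  ≡⟨ isYes≗does (u ≟ᵥ v) ⟩
    does (u ≟ᵥ v)   ≡⟨ does-⇔ (mk⇔ sym sym) (u ≟ᵥ v) (v ≟ᵥ u) ⟩
    does (v ≟ᵥ u)   ≡⟨ sym (isYes≗does (v ≟ᵥ u)) ⟩
    isYes (v ≟ᵥ u)  ∎
  where open ≡-Reasoning

==ᵢ⇒≡ : ∀ {k f} (i j : Idx k f) → (i ==ᵢ j) ≡ true → i ≡ j
==ᵢ⇒≡ (hi , lo) (hi' , lo') e with ∧-true e
... | e₁ , e₂ = cong₂ _,_ (==⇒≡ hi hi' e₁) (==⇒≡ lo lo' e₂)

==ᵢ-refl : ∀ {k f} (i : Idx k f) → (i ==ᵢ i) ≡ true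
==ᵢ-refl (hi , lo) rewrite ==-refl hi | ==-refl lo = refl

==-∷ : ∀ {f} (x y : Bool) (u w : Bits f) → ((x ∷ u) == (y ∷ w)) ≡ (isYes (x Boolₚ.≟ y) ∧ (u == w))
==-∷ x y u w with x Boolₚ.≟ y | u ≟ᵥ w
... | yes _ | yes _ = refl
... | yes _ | no _  = refl
... | no _  | yes _ = refl
... | no _  | no _  = refl

∑-allBits : ∀ {f} (g : Bits (suc f) → ℕ) →
  ∑ (allBits (suc f)) g ≡ ∑[ w ← allBits f ] g (true ∷ w) + ∑[ w ← allBits f ] g (false ∷ w)
∑-allBits {f} g = begin
    ∑ (allBits (suc f)) g
      ≡⟨ ∑-concatMap (λ x → List.map (x ∷_) (allBits f)) (true ∷ false ∷ []) g ⟩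
    ∑ (List.map (true ∷_) (allBits f)) g + (∑ (List.map (false ∷_) (allBits f)) g + 0)
      ≡⟨ cong₂ _+_ (∑-map _ (allBits f) g) (+-identityʳ _) ⟩
    ∑[ w ← allBits f ] g (true ∷ w) + ∑ (List.map (false ∷_) (allBits f)) g
      ≡⟨ cong (∑[ w ← allBits f ] g (true ∷ w) +_) (∑-map _ (allBits f) g) ⟩
    ∑[ w ← allBits f ] g (true ∷ w) + ∑[ w ← allBits f ] g (false ∷ w)  ∎
  where open ≡-Reasoning

==-count : ∀ {f} (v : Bits f) → ∑[ w ← allBits f ] ⟦ v == w ⟧ ≡ 1
==-count []            = refl
==-count {suc f} (x ∷ v) = begin
    ∑[ w ← allBits (suc f) ] ⟦ (x ∷ v) == w ⟧
      ≡⟨ ∑-allBits {f} (λ w → ⟦ (x ∷ v) == w ⟧) ⟩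
    ∑[ w ← allBits f ] ⟦ (x ∷ v) == (true ∷ w) ⟧ + ∑[ w ← allBits f ] ⟦ (x ∷ v) == (false ∷ w) ⟧
      ≡⟨ cong₂ _+_ (∑-cong (allBits f) (λ w → cong ⟦_⟧ (==-∷ x true v w)))
                   (∑-cong (allBits f) (λ w → cong ⟦_⟧ (==-∷ x false v w))) ⟩
    ∑[ w ← allBits f ] ⟦ isYes (x Boolₚ.≟ true) ∧ (v == w) ⟧
      + ∑[ w ← allBits f ] ⟦ isYes (x Boolₚ.≟ false) ∧ (v == w) ⟧
      ≡⟨ leadingBit x ⟩
    1  ∎
  where
  open ≡-Reasoning
  leadingBit : ∀ x → ∑[ w ← allBits f ] ⟦ isYes (x Boolₚ.≟ true) ∧ (v == w) ⟧
                     + ∑[ w ← allBits f ] ⟦ isYes (x Boolₚ.≟ false) ∧ (v == w) ⟧ ≡ 1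
  leadingBit true  = cong₂ _+_ (==-count v) (∑-zero (allBits f))
  leadingBit false = cong₂ _+_ (∑-zero (allBits f)) (==-count v)

==ᵢ-count : ∀ {k f} (i : Idx k f) → ∑[ c ← allIdx k f ] ⟦ i ==ᵢ c ⟧ ≡ 1
==ᵢ-count {k} {f} (hi , lo) = begin
    ∑[ c ← allIdx k f ] ⟦ (hi , lo) ==ᵢ c ⟧
      ≡⟨ ∑-cartesian (allBits k) (allBits f) _ ⟩
    ∑[ h ← allBits k ] ∑[ l ← allBits f ] ⟦ (hi == h) ∧ (lo == l) ⟧
      ≡⟨ ∑-cong (allBits k) (λ h → ∑-cong (allBits f) (λ l → ⟦∧⟧ (hi == h) (lo == l))) ⟩
    ∑[ h ← allBits k ] ∑[ l ← allBits f ] (⟦ hi == h ⟧ * ⟦ lo == l ⟧)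
      ≡⟨ ∑-cong (allBits k) (λ h → ∑-*ˡ (allBits f) ⟦ hi == h ⟧ _) ⟩
    ∑[ h ← allBits k ] (⟦ hi == h ⟧ * ∑[ l ← allBits f ] ⟦ lo == l ⟧)
      ≡⟨ ∑-cong (allBits k) (λ h → cong (⟦ hi == h ⟧ *_) (==-count lo)) ⟩
    ∑[ h ← allBits k ] (⟦ hi == h ⟧ * 1)
      ≡⟨ ∑-*ʳ (allBits k) 1 _ ⟩
    ∑[ h ← allBits k ] ⟦ hi == h ⟧ * 1
      ≡⟨ cong (_* 1) (==-count hi) ⟩
    1  ∎
  where open ≡-Reasoning

==-count-Fingerprints : ∀ {f} (v : Bits f) → ∑[ a ← Fingerprints f ] ⟦ v == a ⟧ ≤ 1
==-count-Fingerprints {f} v = ≤-trans (∑-filter-≤ isNonzero (allBits f) _) (≤-reflexive (==-count v))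

length-allBits : ∀ f → length (allBits f) ≡ 2 ^ f
length-allBits zero    = refl
length-allBits (suc f) = begin
    length (allBits (suc f))                                ≡⟨ length≡∑1 (allBits (suc f)) ⟩
    ∑[ _ ← allBits (suc f) ] 1                              ≡⟨ ∑-allBits {f} (λ _ → 1) ⟩
    ∑[ _ ← allBits f ] 1 + ∑[ _ ← allBits f ] 1             ≡⟨ cong₂ _+_ halves halves ⟩
    2 ^ f + 2 ^ f                                          ≡⟨ cong (2 ^ f +_) (sym (+-identityʳ (2 ^ f))) ⟩
    2 ^ suc f                                              ∎
  where
  open ≡-Reasoning
  halves : ∑[ _ ← allBits f ] 1 ≡ 2 ^ f
  halves = trans (sym (length≡∑1 (allBits f))) (length-allBits f)

length-allIdx : ∀ k f → length (allIdx k f) ≡ 2 ^ (k + f)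
length-allIdx k f = begin
    length (allIdx k f)                                 ≡⟨ length≡∑1 (allIdx k f) ⟩
    ∑[ _ ← allIdx k f ] 1                               ≡⟨ ∑-cartesian (allBits k) (allBits f) _ ⟩
    ∑[ _ ← allBits k ] ∑[ _ ← allBits f ] 1             ≡⟨ ∑-const (allBits k) _ ⟩
    length (allBits k) * ∑[ _ ← allBits f ] 1           ≡⟨ cong (length (allBits k) *_) (sym (length≡∑1 (allBits f))) ⟩
    length (allBits k) * length (allBits f)             ≡⟨ cong₂ _*_ (length-allBits k) (length-allBits f) ⟩
    2 ^ k * 2 ^ f                                       ≡⟨ sym (^-distribˡ-+-* 2 k f) ⟩
    2 ^ (k + f)                                         ∎
  where open ≡-Reasoning

length-Fingerprints : ∀ f → length (Fingerprints f) ≡ 2 ^ f ∸ 1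
length-Fingerprints f = begin
    length (Fingerprints f)            ≡⟨ sym (m+n∸n≡m (length (Fingerprints f)) 1) ⟩
    length (Fingerprints f) + 1 ∸ 1    ≡⟨ cong (_∸ 1) withZero ⟩
    2 ^ f ∸ 1                          ∎
  where
  open ≡-Reasoning
  zeros : Bits f
  zeros = replicate f false
  isZero : ∀ w → ⟦ zeros == w ⟧ ≡ ⟦ not (isNonzero w) ⟧
  isZero w = cong ⟦_⟧ (trans (==-sym zeros w) (sym (Boolₚ.not-involutive (w == zeros))))
  withZero : length (Fingerprints f) + 1 ≡ 2 ^ f
  withZero = begin
      length (Fingerprints f) + 1
        ≡⟨ cong₂ _+_ (count≡∑ isNonzero (allBits f)) (sym (==-count zeros)) ⟩
      ∑[ w ← allBits f ] ⟦ isNonzero w ⟧ + ∑[ w ← allBits f ] ⟦ zeros == w ⟧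
        ≡⟨ cong (∑[ w ← allBits f ] ⟦ isNonzero w ⟧ +_) (∑-cong (allBits f) isZero) ⟩
      ∑[ w ← allBits f ] ⟦ isNonzero w ⟧ + ∑[ w ← allBits f ] ⟦ not (isNonzero w) ⟧
        ≡⟨ sym (∑-+ (allBits f) _ _) ⟩
      ∑[ w ← allBits f ] (⟦ isNonzero w ⟧ + ⟦ not (isNonzero w) ⟧)
        ≡⟨ ∑-cong (allBits f) (λ w → ⟦⟧+⟦not⟧ (isNonzero w)) ⟩
      ∑[ _ ← allBits f ] 1
        ≡⟨ sym (length≡∑1 (allBits f)) ⟩
      length (allBits f)
        ≡⟨ length-allBits f ⟩
      2 ^ f  ∎

⊕-involutive : ∀ {k f} (i : Idx k f) (φ : Bits f) → (i ⊕ φ) ⊕ φ ≡ i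
⊕-involutive (hi , lo) φ = cong (hi ,_) (xor-cancel lo φ)
  where
  xor-cancel : ∀ {f} (l a : Bits f) → zipWith _xor_ (zipWith _xor_ l a) a ≡ l
  xor-cancel []      []      = refl
  xor-cancel (x ∷ l) (y ∷ a) = cong₂ _∷_ bit (xor-cancel l a)
    where
    bit : (x xor y) xor y ≡ x
    bit = trans (Boolₚ.xor-assoc x y y)
                (trans (cong (x xor_) (Boolₚ.xor-same y)) (Boolₚ.xor-identityʳ x))

Cells : ∀ {k f} → Bits f → Idx k f → Idx k f → Set
Cells φ i j = j ≡ i ⊎ j ≡ i ⊕ φ

cells-sym : ∀ {k f} {φ : Bits f} {i j : Idx k f} → Cells φ i j → Cells φ j i
cells-sym             (inj₁ refl) = inj₁ refl
cells-sym {φ = φ} {i} (inj₂ refl) = inj₂ (sym (⊕-involutive i φ))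

cells-trans : ∀ {k f} {φ : Bits f} {i j l : Idx k f} → Cells φ i j → Cells φ j l → Cells φ i l
cells-trans             (inj₁ refl) q           = q
cells-trans             (inj₂ refl) (inj₁ refl) = inj₂ refl
cells-trans {φ = φ} {i} (inj₂ refl) (inj₂ refl) = inj₁ (⊕-involutive i φ)

min-cells : ∀ {k f} (i : Idx k f) (φ : Bits f) → Cells φ i (minIdx i (i ⊕ φ))
min-cells i φ with idxVal i ≤ᵇ idxVal (i ⊕ φ)
... | true  = inj₁ refl
... | false = inj₂ refl

stash-determines-cells : ∀ {k f} (h c : Idx k f) (φ : Bits f) →
  proj₁ h ≡ proj₁ c → stashLoc h φ ≡ stashLoc c φ → Cells φ h c
stash-determines-cells {k} {f} h c φ sameSubtable sameLoc =
  cells-trans (min-cells h φ) (subst (λ m → Cells φ m c) (sym sameMin) (cells-sym (min-cells c φ)))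
  where
  subtable : ∀ {i j : Idx k f} → Cells φ i j → proj₁ j ≡ proj₁ i
  subtable (inj₁ refl) = refl
  subtable (inj₂ refl) = refl
  sameMin : minIdx h (h ⊕ φ) ≡ minIdx c (c ⊕ φ)
  sameMin = cong₂ _,_ (trans (subtable (min-cells h φ))
                             (trans sameSubtable (sym (subtable (min-cells c φ)))))
                      sameLoc

home : ∀ {k f} → Bits f → Idx k f → Loc → Idx k f
home φ h (just s) = cellOf h φ s
home φ h nothing  = h

covers : ∀ {k f} → Bits f → Idx k f → Loc → Bits f → Idx k f → Bool
covers φ h (just s) a c = (φ == a) ∧ ((cellOf h φ s ==ᵢ c) ∨ (cellOf h φ s ==ᵢ (c ⊕ a)))
covers φ h nothing  a c = (proj₁ h == proj₁ c) ∧ (stashLoc h φ == stashLoc c a) ∧ (φ == a)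

covers-cells : ∀ {k f} (φ : Bits f) (h : Idx k f) (l : Loc) (a : Bits f) (c : Idx k f) →
  covers φ h l a c ≡ true → φ ≡ a × Cells a (home φ h l) c
covers-cells φ h (just s) a c e with ∧-true e
... | sameFp , inCell with ==⇒≡ φ a sameFp | ∨-true {x = cellOf h φ s ==ᵢ c} inCell
...   | refl | inj₁ e₁ = refl , inj₁ (sym (==ᵢ⇒≡ (cellOf h φ s) c e₁))
...   | refl | inj₂ e₂ = refl , inj₂ (trans (sym (⊕-involutive c φ)) (cong (_⊕ φ) (sym (==ᵢ⇒≡ (cellOf h φ s) (c ⊕ φ) e₂))))
covers-cells φ h nothing a c e with ∧-true e
... | sameSubtable , rest with ∧-true rest
...   | sameLoc , sameFp with ==⇒≡ φ a sameFp
...     | refl = refl , stash-determines-cells h c φ (==⇒≡ _ _ sameSubtable) (==⇒≡ _ _ sameLoc)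

covers-≤ : ∀ {k f} (φ : Bits f) (h : Idx k f) (l : Loc) (a : Bits f) (c : Idx k f) →
  ⟦ covers φ h l a c ⟧ ≤ ⟦ φ == a ⟧ * (⟦ home φ h l ==ᵢ c ⟧ + ⟦ (home φ h l ⊕ a) ==ᵢ c ⟧)
covers-≤ {k} {f} φ h l a c = ⟦⟧-≤ (covers φ h l a c) (λ e → indicators (covers-cells φ h l a c e))
  where
  E : Idx k f
  E = home φ h l
  indicators : φ ≡ a × Cells a E c → 1 ≤ ⟦ φ == a ⟧ * (⟦ E ==ᵢ c ⟧ + ⟦ (E ⊕ a) ==ᵢ c ⟧)
  indicators (refl , inj₁ refl) rewrite ==-refl φ | ==ᵢ-refl E = s≤s z≤n
  indicators (refl , inj₂ refl) rewrite ==-refl φ | ==ᵢ-refl (E ⊕ φ) =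
    ≤-trans (m≤n+m 1 ⟦ E ==ᵢ (E ⊕ φ) ⟧) (m≤m+n _ 0)

covers-count : ∀ {k f} (φ : Bits f) (h : Idx k f) (l : Loc) →
  ∑[ a ← Fingerprints f ] ∑[ c ← allIdx k f ] ⟦ covers φ h l a c ⟧ ≤ 2
covers-count {k} {f} φ h l = begin
    ∑[ a ← Fps ] ∑[ c ← Ixs ] ⟦ covers φ h l a c ⟧
      ≤⟨ ∑-mono Fps (λ a → ∑-mono Ixs (λ c → covers-≤ φ h l a c)) ⟩
    ∑[ a ← Fps ] ∑[ c ← Ixs ] (⟦ φ == a ⟧ * (⟦ E ==ᵢ c ⟧ + ⟦ (E ⊕ a) ==ᵢ c ⟧))
      ≡⟨ ∑-cong Fps (λ a → ∑-*ˡ Ixs ⟦ φ == a ⟧ _) ⟩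
    ∑[ a ← Fps ] (⟦ φ == a ⟧ * ∑[ c ← Ixs ] (⟦ E ==ᵢ c ⟧ + ⟦ (E ⊕ a) ==ᵢ c ⟧))
      ≡⟨ ∑-cong Fps (λ a → cong (⟦ φ == a ⟧ *_) (twoCells a)) ⟩
    ∑[ a ← Fps ] (⟦ φ == a ⟧ * 2)
      ≡⟨ ∑-*ʳ Fps 2 _ ⟩
    ∑[ a ← Fps ] ⟦ φ == a ⟧ * 2
      ≤⟨ *-monoˡ-≤ 2 (==-count-Fingerprints φ) ⟩
    2  ∎
  where
  open ≤-Reasoning
  Fps : List (Bits f)
  Fps = Fingerprints f
  Ixs : List (Idx k f)
  Ixs = allIdx k f
  E : Idx k f
  E = home φ h l
  twoCells : ∀ a → ∑[ c ← Ixs ] (⟦ E ==ᵢ c ⟧ + ⟦ (E ⊕ a) ==ᵢ c ⟧) ≡ 2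
  twoCells a = trans (∑-+ Ixs _ _) (cong₂ _+_ (==ᵢ-count E) (==ᵢ-count (E ⊕ a)))

query-covered : ∀ {k f n} (mode : Mode) (Φ : Vec (Bits f) n) (H : Vec (Idx k f) n) (ls : Vec Loc n)
  (a : Bits f) (c : Idx k f) →
  ⟦ query mode Φ H ls a c ⟧ ≤ ∑[ i ← allFin n ] ⟦ covers (lookup Φ i) (lookup H i) (lookup ls i) a c ⟧
query-covered {n = n} mode Φ H ls a c = ⟦⟧-≤ (query mode Φ H ls a c) (positive mode)
  where
  coveredBy : Fin n → ℕ
  coveredBy i = ⟦ covers (lookup Φ i) (lookup H i) (lookup ls i) a c ⟧
  witnessed : ∀ {i} → i List.∈ allFin n → coveredBy i ≡ 1 → 1 ≤ ∑ (allFin n) coveredBy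
  witnessed {i} i∈ e = ≤-trans (≤-reflexive (sym e)) (∑-member coveredBy i∈)
  -- the table part only fires for stored elements, the stash part only for stashed ones
  positive : (md : Mode) → query md Φ H ls a c ≡ true → 1 ≤ ∑ (allFin n) coveredBy
  positive md e with ∨-true {x = anyₗ _ (allFin n)} e
  ... | inj₁ tableHit with any-witness _ (allFin n) tableHit
  ...   | i , i∈ , hit with lookup ls i in el
  ...     | just s  = witnessed i∈ (subst (λ l → ⟦ covers (lookup Φ i) (lookup H i) l a c ⟧ ≡ 1)
                                          (sym el) (cong ⟦_⟧ hit))
  ...     | nothing = ⊥-elim (false≢true hit)
  positive noStash   e | inj₂ ()
  positive withStash e | inj₂ stashHit with any-witness _ (allFin n) stashHit
  ...   | i , i∈ , hit with lookup ls i in el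
  ...     | nothing = witnessed i∈ (subst (λ l → ⟦ covers (lookup Φ i) (lookup H i) l a c ⟧ ≡ 1)
                                          (sym el) (cong ⟦_⟧ hit))
  ...     | just s  = ⊥-elim (false≢true hit)

query-count : ∀ {k f n} (mode : Mode) (Φ : Vec (Bits f) n) (H : Vec (Idx k f) n) (ls : Vec Loc n) →
  ∑[ a ← Fingerprints f ] ∑[ c ← allIdx k f ] ⟦ query mode Φ H ls a c ⟧ ≤ 2 * n
query-count {k} {f} {n} mode Φ H ls = begin
    ∑[ a ← Fps ] ∑[ c ← Ixs ] ⟦ query mode Φ H ls a c ⟧
      ≤⟨ ∑-mono Fps (λ a → ∑-mono Ixs (λ c → query-covered mode Φ H ls a c)) ⟩
    ∑[ a ← Fps ] ∑[ c ← Ixs ] ∑[ i ← I ] cover i a c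
      ≡⟨ ∑-cong Fps (λ a → ∑-swap Ixs I (λ c i → cover i a c)) ⟩
    ∑[ a ← Fps ] ∑[ i ← I ] ∑[ c ← Ixs ] cover i a c
      ≡⟨ ∑-swap Fps I (λ a i → ∑[ c ← Ixs ] cover i a c) ⟩
    ∑[ i ← I ] ∑[ a ← Fps ] ∑[ c ← Ixs ] cover i a c
      ≤⟨ ∑-mono I (λ i → covers-count (lookup Φ i) (lookup H i) (lookup ls i)) ⟩
    ∑[ _ ← I ] 2
      ≡⟨ ∑-const I 2 ⟩
    length I * 2
      ≡⟨ cong (_* 2) (length-tabulate {n = n} (λ i → i)) ⟩
    n * 2
      ≡⟨ *-comm n 2 ⟩
    2 * n  ∎
  where
  open ≤-Reasoning
  Fps : List (Bits f)
  Fps = Fingerprints f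
  Ixs : List (Idx k f)
  Ixs = allIdx k f
  I : List (Fin n)
  I = allFin n
  cover : Fin n → Bits f → Idx k f → ℕ
  cover i a c = ⟦ covers (lookup Φ i) (lookup H i) (lookup ls i) a c ⟧

stored : ∀ {m n} → Vec (Fin m) n → Vec A m → Vec A n
stored S v = map (lookup v) S

stored-update : ∀ {m n} (S : Vec (Fin m) n) {y : Fin m} (v : Vec A m) (a : A) →
  ¬ (y ∈ S) → stored S (v [ y ]≔ a) ≡ stored S v
stored-update []      v a y∉S = refl
stored-update (x ∷ S) v a y∉S =
  cong₂ _∷_ (Vecₚ.lookup∘update′ (λ x≡y → y∉S (VecAny.here (sym x≡y))) v a)
            (stored-update S v a (λ y∈S → y∉S (VecAny.there y∈S)))

module _ {n k f : ℕ} (mode : Mode) (b : ℕ) (Φ : Vec (Bits f) n) (H : Vec (Idx k f) n) where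

  succeeded : Maybe (Vec Loc n) → Bool
  succeeded (just ls) = valid mode b Φ H ls
  succeeded nothing   = false

  succeededAndPositive : Maybe (Vec Loc n) → Bits f → Idx k f → Bool
  succeededAndPositive (just ls) a c = valid mode b Φ H ls ∧ query mode Φ H ls a c
  succeededAndPositive nothing   a c = false

  positive-count : (r : Maybe (Vec Loc n)) →
    ∑[ a ← Fingerprints f ] ∑[ c ← allIdx k f ] ⟦ succeededAndPositive r a c ⟧ ≤ 2 * n * ⟦ succeeded r ⟧
  positive-count nothing = ≤-trans (≤-reflexive (∑-zero₂ (Fingerprints f) (allIdx k f))) z≤n
  positive-count (just ls) with valid mode b Φ H ls
  ... | true  = ≤-trans (query-count mode Φ H ls) (≤-reflexive (sym (*-identityʳ (2 * n))))
  ... | false = ≤-trans (≤-reflexive (∑-zero₂ (Fingerprints f) (allIdx k f))) z≤n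

module _ {m n k f : ℕ} (mode : Mode) (b : ℕ) (rule : Rule n k f) (S : Vec (Fin m) n) where

  built-unfold : (φ : Vec (Bits f) m) (h : Vec (Idx k f) m) →
    built mode b rule S (φ , h)
    ≡ succeeded mode b (stored S φ) (stored S h) (rule (stored S φ) (stored S h))
  built-unfold φ h with rule (map (lookup φ) S) (map (lookup h) S)
  ... | just ls = refl
  ... | nothing = refl

  positive-unfold : (y : Fin m) (φ : Vec (Bits f) m) (h : Vec (Idx k f) m) →
    builtAndPositive mode b rule S y (φ , h)
    ≡ succeededAndPositive mode b (stored S φ) (stored S h) (rule (stored S φ) (stored S h)) (lookup φ y) (lookup h y)
  positive-unfold y φ h with rule (map (lookup φ) S) (map (lookup h) S)
  ... | just ls = refl
  ... | nothing = refl

  resampled-unfold : ∀ {y} → ¬ (y ∈ S) → (φ : Vec (Bits f) m) (h : Vec (Idx k f) m) (a : Bits f) (c : Idx k f) →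
    builtAndPositive mode b rule S y (φ [ y ]≔ a , h [ y ]≔ c)
    ≡ succeededAndPositive mode b (stored S φ) (stored S h) (rule (stored S φ) (stored S h)) a c
  resampled-unfold {y} y∉S φ h a c
    rewrite positive-unfold y (φ [ y ]≔ a) (h [ y ]≔ c)
          | stored-update S φ a y∉S | stored-update S h c y∉S
          | Vecₚ.lookup∘update y φ a | Vecₚ.lookup∘update y h c = refl

  resampled-bound : ∀ {y} → ¬ (y ∈ S) → (φ : Vec (Bits f) m) (h : Vec (Idx k f) m) →
    ∑[ a ← Fingerprints f ] ∑[ c ← allIdx k f ] ⟦ builtAndPositive mode b rule S y (φ [ y ]≔ a , h [ y ]≔ c) ⟧
    ≤ 2 * n * ⟦ built mode b rule S (φ , h) ⟧
  resampled-bound y∉S φ h = begin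
    ∑[ a ← Fingerprints f ] ∑[ c ← allIdx k f ] ⟦ builtAndPositive mode b rule S _ (φ [ _ ]≔ a , h [ _ ]≔ c) ⟧
      ≡⟨ ∑-cong (Fingerprints f) (λ a → ∑-cong (allIdx k f) (λ c →
           cong ⟦_⟧ (resampled-unfold y∉S φ h a c))) ⟩
    ∑[ a ← Fingerprints f ] ∑[ c ← allIdx k f ] ⟦ succeededAndPositive mode b Φ H (rule Φ H) a c ⟧
      ≤⟨ positive-count mode b Φ H (rule Φ H) ⟩
    2 * n * ⟦ succeeded mode b Φ H (rule Φ H) ⟧
      ≡⟨ cong (λ z → 2 * n * ⟦ z ⟧) (sym (built-unfold φ h)) ⟩
    2 * n * ⟦ built mode b rule S (φ , h) ⟧  ∎
    where
    open ≤-Reasoning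
    Φ : Vec (Bits f) n
    Φ = stored S φ
    H : Vec (Idx k f) n
    H = stored S h

mainTheorem3 : (mode : Mode) (m n k f b : ℕ) (S : Vec (Fin m) n) (y : Fin m)
    → (∀ i j → lookup S i ≡ lookup S j → i ≡ j)
    → ¬ (y ∈ S)
    → (rule : Rule n k f)
    → count (builtAndPositive mode b rule S y) (HashSpace m k f) * (2 ^ (k + f) * (2 ^ f ∸ 1))
      ≤ 2 * n * count (built mode b rule S) (HashSpace m k f)
mainTheorem3 mode m n k f b S y _ y∉S rule = begin
    count positive Ω * (2 ^ (k + f) * (2 ^ f ∸ 1))
      ≡⟨ cong₂ (λ N F → count positive Ω * (N * F)) (sym (length-allIdx k f)) (sym (length-Fingerprints f)) ⟩
    count positive Ω * (length (allIdx k f) * length (Fingerprints f))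
      ≡⟨ cong (_* _) (count-HashSpace positive) ⟩
    (∑[ φ ← Φs ] ∑[ h ← Hs ] ⟦ positive (φ , h) ⟧) * (length (allIdx k f) * length (Fingerprints f))
      ≡⟨ ∑-resample₂ (Fingerprints f) (allIdx k f) y (λ φ h → ⟦ positive (φ , h) ⟧) ⟩
    ∑[ φ ← Φs ] ∑[ h ← Hs ] ∑[ a ← Fingerprints f ] ∑[ c ← allIdx k f ] ⟦ positive (φ [ y ]≔ a , h [ y ]≔ c) ⟧
      ≤⟨ ∑-mono Φs (λ φ → ∑-mono Hs (λ h → resampled-bound mode b rule S y∉S φ h)) ⟩
    ∑[ φ ← Φs ] ∑[ h ← Hs ] (2 * n * ⟦ isBuilt (φ , h) ⟧)
      ≡⟨ trans (∑-cong Φs (λ φ → ∑-*ˡ Hs (2 * n) _)) (∑-*ˡ Φs (2 * n) _) ⟩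
    2 * n * ∑[ φ ← Φs ] ∑[ h ← Hs ] ⟦ isBuilt (φ , h) ⟧
      ≡⟨ cong (2 * n *_) (sym (count-HashSpace isBuilt)) ⟩
    2 * n * count isBuilt Ω  ∎
  where
  open ≤-Reasoning
  Ω : List (Vec (Bits f) m × Vec (Idx k f) m)
  Ω = HashSpace m k f
  positive : Vec (Bits f) m × Vec (Idx k f) m → Bool
  positive = builtAndPositive mode b rule S y
  isBuilt : Vec (Bits f) m × Vec (Idx k f) m → Bool
  isBuilt = built mode b rule S
  Φs : List (Vec (Bits f) m)
  Φs = allVec (Fingerprints f) m
  Hs : List (Vec (Idx k f) m)
  Hs = allVec (allIdx k f) m
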